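{- Let $\mathcal F$ be a $P_3$-free $3$-graph with $n\ge 6$ vertices that covers pairs, and let $i,j\in V(\mathcal F)$ be distinct. Then $\pi_{ij}(\mathcal F)$ is $P_3$-free. Furthermore, if $\mathcal F$ is also $K_6^3$-free, then $\pi_{ij}(\mathcal F)$ is $K_6^3$-free.
   Context: A $3$-graph is a set of $3$-element subsets (edges) of a finite vertex set; it is $H$-free if it has no subgraph isomorphic to $H$. $K_6^3$ is the complete $3$-graph on $6$ vertices. $P_3$ is the $3$-uniform linear path of length $3$: edges $e_1,e_2,e_3$ with $|e_1\cap e_2|=|e_2\cap e_3|=1$ and $e_1\cap e_3=\emptyset$. A $3$-graph covers pairs if every pair of its vertices lies in some edge. For distinct vertices $i,j$ of $G$, let $L_G(j\setminus i)=\{f\in\binom{V(G)\setminus\{i,j\}}{2}: f\cup\{j\}\in G,\ f\cup\{i\}\notin G\}$ and define the compression $\pi_{ij}(G)=\big(G\setminus\{f\cup\{j\}: f\in L_G(j\setminus i)\}\big)\cup\{f\cup\{i\}: f\in L_G(j\setminus i)\}$. -}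

module Defs where

open import Data.Nat using (ℕ; _≡ᵇ_)
open import Data.Bool using (Bool; true; false; _∧_; _∨_; not; T)
open import Data.Fin using (Fin)
open import Data.Fin.Subset using (Subset; _∈_; _⊆_; _∩_; ∣_∣)
open import Data.Vec using (lookup; _[_]≔_)
open import Data.Product using (Σ; _×_)
open import Data.Empty using (⊥)
open import Relation.Nullary using (¬_)
open import Relation.Binary.PropositionalEquality using (_≡_; _≢_)

Graph : ℕ → Set
Graph n = Subset n → Bool

Is3Graph : ∀ {n} → Graph n → Set
Is3Graph {n} G = (e : Subset n) → T (G e) → ∣ e ∣ ≡ 3

CoversPairs : ∀ {n} → Graph n → Set
CoversPairs {n} G = (x y : Fin n) → x ≢ y → Σ (Subset n) λ e → T (G e) × x ∈ e × y ∈ e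

P3Free : ∀ {n} → Graph n → Set
P3Free {n} G = (e₁ e₂ e₃ : Subset n) → T (G e₁) → T (G e₂) → T (G e₃) →
  ∣ e₁ ∩ e₂ ∣ ≡ 1 → ∣ e₂ ∩ e₃ ∣ ≡ 1 → ∣ e₁ ∩ e₃ ∣ ≡ 0 → ⊥

K6Free : ∀ {n} → Graph n → Set
K6Free {n} G = ¬ (Σ (Subset n) λ S → ∣ S ∣ ≡ 6 ×
  ((e : Subset n) → e ⊆ S → ∣ e ∣ ≡ 3 → T (G e)))

move : ∀ {n} → Fin n → Fin n → Subset n → Subset n
move a b e = (e [ a ]≔ false) [ b ]≔ true

-- Writing f = e ∖ {j} (resp. f = e ∖ {i}):
--  * e = f ∪ {j} with f ∈ L_G(j∖i) iff |e| = 3, j ∈ e, i ∉ e, e ∈ G, move j i e ∉ G;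
--  * e = f ∪ {i} with f ∈ L_G(j∖i) iff |e| = 3, i ∈ e, j ∉ e, move i j e ∈ G, e ∉ G.
-- π_{ij}(G) = (G minus the first kind) ∪ (second kind).
compress : ∀ {n} → Fin n → Fin n → Graph n → Graph n
compress i j G e =
  (G e ∧ not ((∣ e ∣ ≡ᵇ 3) ∧ lookup e j ∧ not (lookup e i) ∧ not (G (move j i e))))
  ∨ ((∣ e ∣ ≡ᵇ 3) ∧ lookup e i ∧ not (lookup e j) ∧ G (move i j e) ∧ not (G e))

-- Disjoint edges e, f of a P3-free 3-graph that covers pairs cover every vertex: for x outside
-- e ∪ f, pair-covering gives an edge through x and a vertex of e, one through x and a vertex of f,
-- and one joining e to f, and in every configuration three of these edges form a linear path.
-- This covering property alone excludes linear paths (the middle edge of a path has a vertex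
-- outside both end edges), and π_ij preserves it: undoing the shift of a new edge f ∪ {i}, and
-- shifting a disjoint old edge through j if there is one, turns two disjoint edges of π_ij into
-- two disjoint edges of F missing the same vertex, or missing i.
-- A complete 6-set of π_ij avoiding j would split into two disjoint edges missing j. If it
-- contains j, each new edge f ∪ {i} inside it forces f ∪ {j} to survive in π_ij, which means
-- f ∪ {i} ∈ F; so the 6-set is already complete in F.
module Submission where

open import Data.Nat using (ℕ; suc; _+_; _≥_)
open import Data.Nat.Properties using (suc-injective; ≡ᵇ⇒≡; ≡⇒≡ᵇ)
open import Data.Bool using (true; false; _∧_; not; T)
open import Data.Bool.Properties using (T-∧; T-∨; T-≡)
open import Data.Fin using (Fin)
open import Data.Fin.Properties using (_≟_)
open import Data.Fin.Subset
  using (Subset; inside; outside; _∈_; _∉_; _⊆_; _∩_; _∪_; _─_; _-_; ⁅_⁆; ∣_∣; Nonempty; Empty)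
open import Data.Fin.Subset.Properties
open import Data.Vec using (_∷_; lookup; _[_]≔_; here; there)
open import Data.Vec.Properties
  using ([]≔-updates; []≔-minimal; []=-injective; lookup∘update′; []=⇒lookup; lookup⇒[]=)
open import Data.Product using (∃; ∃₂; _×_; _,_; proj₁; proj₂)
open import Data.Sum using (_⊎_; inj₁; inj₂; [_,_]′)
import Data.Sum as Sum
open import Data.Empty using (⊥; ⊥-elim)
open import Function using (_∘_; id; case_of_; Equivalence)
open import Relation.Nullary using (yes; no; contradiction)
open import Relation.Binary.PropositionalEquality
open import Defs using (Graph; Is3Graph; CoversPairs; P3Free; K6Free; move; compress)

module _ where

  private
    variable
      n k : ℕ
      p q s t : Subset n
      a b c x y : Fin n

  x∈p─q⇒x∉q : ∀ (p q : Subset n) → x ∈ p ─ q → x ∉ q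
  x∈p─q⇒x∉q (inside ∷ p) (outside ∷ q) here ()
  x∈p─q⇒x∉q (_ ∷ p) (_ ∷ q) (there x∈p─q) (there x∈q) = x∈p─q⇒x∉q p q x∈p─q x∈q

  x∈p-y⇒x≢y : ∀ p → x ∈ p - y → x ≢ y
  x∈p-y⇒x≢y {y = y} p x∈p-y = x∉⁅y⁆⇒x≢y (x∈p─q⇒x∉q p ⁅ y ⁆ x∈p-y)

  x∈p-y⇒x∈p : ∀ p → x ∈ p - y → x ∈ p
  x∈p-y⇒x∈p {y = y} p = p─q⊆p p ⁅ y ⁆

  ∣p∣≡1+∣p-x∣ : x ∈ p → ∣ p ∣ ≡ suc ∣ p - x ∣
  ∣p∣≡1+∣p-x∣ {p = inside ∷ p} here = cong (suc ∘ ∣_∣) (sym (p─⊥≡p p))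
  ∣p∣≡1+∣p-x∣ {p = inside ∷ p} (there x∈p) = cong suc (∣p∣≡1+∣p-x∣ x∈p)
  ∣p∣≡1+∣p-x∣ {p = outside ∷ p} (there x∈p) = ∣p∣≡1+∣p-x∣ x∈p

  ∣p∣≡1+k⇒∣p-x∣≡k : x ∈ p → ∣ p ∣ ≡ suc k → ∣ p - x ∣ ≡ k
  ∣p∣≡1+k⇒∣p-x∣≡k x∈p ∣p∣≡1+k = suc-injective (trans (sym (∣p∣≡1+∣p-x∣ x∈p)) ∣p∣≡1+k)

  ∣p∣≡0⇒x∉p : ∣ p ∣ ≡ 0 → x ∉ p
  ∣p∣≡0⇒x∉p ∣p∣≡0 x∈p with () ← trans (sym (∣p∣≡1+∣p-x∣ x∈p)) ∣p∣≡0

  Empty⇒∣p∣≡0 : Empty p → ∣ p ∣ ≡ 0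
  Empty⇒∣p∣≡0 {n} empty = trans (cong ∣_∣ (Empty-unique empty)) (∣⊥∣≡0 n)

  ∣p∣≡1+k⇒Nonempty : ∣ p ∣ ≡ suc k → Nonempty p
  ∣p∣≡1+k⇒Nonempty {p = p} ∣p∣≡1+k with nonempty? p
  ... | yes ne = ne
  ... | no empty with () ← trans (sym ∣p∣≡1+k) (Empty⇒∣p∣≡0 empty)

  remove-element : ∣ p ∣ ≡ suc k → ∃ λ x → x ∈ p × ∣ p - x ∣ ≡ k
  remove-element ∣p∣≡1+k =
    let x , x∈p = ∣p∣≡1+k⇒Nonempty ∣p∣≡1+k in x , x∈p , ∣p∣≡1+k⇒∣p-x∣≡k x∈p ∣p∣≡1+k

  ∣p∣≡1⇒x≡y : ∣ p ∣ ≡ 1 → x ∈ p → y ∈ p → x ≡ y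
  ∣p∣≡1⇒x≡y {x = x} {y = y} ∣p∣≡1 x∈p y∈p with y ≟ x
  ... | yes y≡x = sym y≡x
  ... | no y≢x = contradiction (x∈p∧x≢y⇒x∈p-y y∈p y≢x) (∣p∣≡0⇒x∉p (∣p∣≡1+k⇒∣p-x∣≡k x∈p ∣p∣≡1))

  ∣p∣≡1⁺ : x ∈ p → (∀ {y} → y ∈ p → y ≡ x) → ∣ p ∣ ≡ 1
  ∣p∣≡1⁺ {x = x} {p = p} x∈p unique = trans (∣p∣≡1+∣p-x∣ x∈p) (cong suc (Empty⇒∣p∣≡0 p-x-empty))
    where
    p-x-empty : Empty (p - x)
    p-x-empty (y , y∈p-x) = x∈p-y⇒x≢y p y∈p-x (unique (x∈p-y⇒x∈p p y∈p-x))

  x∈p∧y∉p⇒x≢y : x ∈ p → y ∉ p → x ≢ y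
  x∈p∧y∉p⇒x≢y x∈p y∉p refl = y∉p x∈p

  x∉p∧y∈p⇒x≢y : x ∉ p → y ∈ p → x ≢ y
  x∉p∧y∈p⇒x≢y x∉p y∈p refl = x∉p y∈p

  Disjoint : Subset n → Subset n → Set
  Disjoint p q = ∀ {x} → x ∈ p → x ∉ q

  Disjoint⇒∣p∩q∣≡0 : Disjoint p q → ∣ p ∩ q ∣ ≡ 0
  Disjoint⇒∣p∩q∣≡0 {p = p} {q = q} disj =
    Empty⇒∣p∣≡0 λ (x , x∈p∩q) → let x∈p , x∈q = x∈p∩q⁻ p q x∈p∩q in disj x∈p x∈q

  ∣p∩q∣≡0⇒Disjoint : ∣ p ∩ q ∣ ≡ 0 → Disjoint p q
  ∣p∩q∣≡0⇒Disjoint ∣p∩q∣≡0 x∈p x∈q = ∣p∣≡0⇒x∉p ∣p∩q∣≡0 (x∈p∩q⁺ (x∈p , x∈q))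

  Disjoint-sym : Disjoint p q → Disjoint q p
  Disjoint-sym disj x∈q x∈p = disj x∈p x∈q

  record Triple (s : Subset n) (a b c : Fin n) : Set where
    field
      a∈s : a ∈ s
      b∈s : b ∈ s
      c∈s : c ∈ s
      a≢b : a ≢ b
      a≢c : a ≢ c
      b≢c : b ≢ c
      members : ∀ {x} → x ∈ s → x ≡ a ⊎ x ≡ b ⊎ x ≡ c

  module _ (tr : Triple s a b c) where
    open Triple tr

    Triple-swap : Triple s b a c
    Triple-swap = record
      { a∈s = b∈s ; b∈s = a∈s ; c∈s = c∈s
      ; a≢b = a≢b ∘ sym ; a≢c = b≢c ; b≢c = a≢c
      ; members = [ inj₂ ∘ inj₁ , [ inj₁ , inj₂ ∘ inj₂ ]′ ]′ ∘ members }

    Triple-rotate : Triple s b c a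
    Triple-rotate = record
      { a∈s = b∈s ; b∈s = c∈s ; c∈s = a∈s
      ; a≢b = b≢c ; a≢c = a≢b ∘ sym ; b≢c = a≢c ∘ sym
      ; members = [ inj₂ ∘ inj₂ , [ inj₁ , inj₂ ∘ inj₁ ]′ ]′ ∘ members }

    Triple-∉ : x ≢ a → x ≢ b → x ≢ c → x ∉ s
    Triple-∉ x≢a x≢b x≢c x∈s = [ x≢a , [ x≢b , x≢c ]′ ]′ (members x∈s)

    Triple-Disjoint : ∀ {t} → a ∉ t → b ∉ t → c ∉ t → Disjoint s t
    Triple-Disjoint a∉t b∉t c∉t x∈s x∈t =
      [ (λ { refl → a∉t x∈t }) , [ (λ { refl → b∉t x∈t }) , (λ { refl → c∉t x∈t }) ]′ ]′
        (members x∈s)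

    ∣Triple∩∣≡1 : ∀ {t} → a ∈ t → b ∉ t → c ∉ t → ∣ s ∩ t ∣ ≡ 1
    ∣Triple∩∣≡1 {t} a∈t b∉t c∉t = ∣p∣≡1⁺ (x∈p∩q⁺ (a∈s , a∈t)) λ x∈s∩t →
      let x∈s , x∈t = x∈p∩q⁻ s t x∈s∩t in
      [ id , [ (λ { refl → contradiction x∈t b∉t }) , (λ { refl → contradiction x∈t c∉t }) ]′ ]′
        (members x∈s)

    ∣Triple∣≡3 : ∣ s ∣ ≡ 3
    ∣Triple∣≡3 = begin
      ∣ s ∣              ≡⟨ ∣p∣≡1+∣p-x∣ a∈s ⟩
      suc ∣ s - a ∣       ≡⟨ cong suc (∣p∣≡1+∣p-x∣ b∈s-a) ⟩
      suc (suc ∣ s - a - b ∣) ≡⟨ cong (suc ∘ suc) (∣p∣≡1⁺ c∈s-a-b only-c) ⟩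
      3                  ∎
      where
      open ≡-Reasoning
      b∈s-a : b ∈ s - a
      b∈s-a = x∈p∧x≢y⇒x∈p-y b∈s (a≢b ∘ sym)
      c∈s-a-b : c ∈ s - a - b
      c∈s-a-b = x∈p∧x≢y⇒x∈p-y (x∈p∧x≢y⇒x∈p-y c∈s (a≢c ∘ sym)) (b≢c ∘ sym)
      only-c : ∀ {x} → x ∈ s - a - b → x ≡ c
      only-c {x} x∈s-a-b =
        let x∈s-a = x∈p-y⇒x∈p (s - a) x∈s-a-b in
        [ ⊥-elim ∘ x∈p-y⇒x≢y s x∈s-a , [ ⊥-elim ∘ x∈p-y⇒x≢y (s - a) x∈s-a-b , id ]′ ]′
          (members (x∈p-y⇒x∈p s x∈s-a))

  ∣p∩Triple∣≡1 : Triple t a b c → a ∈ s → b ∉ s → c ∉ s → ∣ s ∩ t ∣ ≡ 1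
  ∣p∩Triple∣≡1 {t = t} {s = s} tr a∈s b∉s c∉s =
    trans (cong ∣_∣ (∩-comm s t)) (∣Triple∩∣≡1 tr a∈s b∉s c∉s)

  ∣s∣≡3⇒Triple : ∣ s ∣ ≡ 3 → a ∈ s → b ∈ s → a ≢ b → ∃ (Triple s a b)
  ∣s∣≡3⇒Triple {s = s} {a = a} {b = b} ∣s∣≡3 a∈s b∈s a≢b
    with ∣s-a-b∣≡1 ← ∣p∣≡1+k⇒∣p-x∣≡k (x∈p∧x≢y⇒x∈p-y b∈s (a≢b ∘ sym)) (∣p∣≡1+k⇒∣p-x∣≡k a∈s ∣s∣≡3)
    with c , c∈s-a-b ← ∣p∣≡1+k⇒Nonempty ∣s-a-b∣≡1
    = c , record
      { a∈s = a∈s ; b∈s = b∈s ; c∈s = x∈p-y⇒x∈p s c∈s-a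
      ; a≢b = a≢b ; a≢c = x∈p-y⇒x≢y s c∈s-a ∘ sym ; b≢c = x∈p-y⇒x≢y (s - a) c∈s-a-b ∘ sym
      ; members = members }
    where
    c∈s-a = x∈p-y⇒x∈p (s - a) c∈s-a-b
    members : ∀ {x} → x ∈ s → x ≡ a ⊎ x ≡ b ⊎ x ≡ c
    members {x} x∈s with x ≟ a | x ≟ b
    ... | yes x≡a | _ = inj₁ x≡a
    ... | no _ | yes x≡b = inj₂ (inj₁ x≡b)
    ... | no x≢a | no x≢b =
      inj₂ (inj₂ (∣p∣≡1⇒x≡y ∣s-a-b∣≡1 (x∈p∧x≢y⇒x∈p-y (x∈p∧x≢y⇒x∈p-y x∈s x≢a) x≢b) c∈s-a-b))

  ∣s∣≡3⇒∃Triple : ∣ s ∣ ≡ 3 → ∃₂ λ a b → ∃ (Triple s a b)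
  ∣s∣≡3⇒∃Triple {s = s} ∣s∣≡3 =
    let a , a∈s , ∣s-a∣≡2 = remove-element ∣s∣≡3
        b , b∈s-a = ∣p∣≡1+k⇒Nonempty ∣s-a∣≡2
    in a , b , ∣s∣≡3⇒Triple ∣s∣≡3 a∈s (x∈p-y⇒x∈p s b∈s-a) (x∈p-y⇒x≢y s b∈s-a ∘ sym)

  Triple-∩-unique : Triple s a b c → ∣ s ∩ t ∣ ≡ 1 → a ∈ t → b ∉ t × c ∉ t
  Triple-∩-unique {s = s} {a = a} {t = t} tr ∣s∩t∣≡1 a∈t =
    (λ b∈t → a≢b (shared b∈s b∈t)) , (λ c∈t → a≢c (shared c∈s c∈t))
    where
    open Triple tr
    shared : ∀ {x} → x ∈ s → x ∈ t → a ≡ x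
    shared x∈s x∈t = ∣p∣≡1⇒x≡y ∣s∩t∣≡1 (x∈p∩q⁺ (a∈s , a∈t)) (x∈p∩q⁺ (x∈s , x∈t))

  Triple-avoids : Triple s a b c → ∣ s ∩ t ∣ ≡ 1 → ∣ s ∩ q ∣ ≡ 1 → ∃ λ x → x ∉ t × x ∉ q
  Triple-avoids {a = a} {b = b} {c = c} {t = t} {q = q} tr ∣s∩t∣≡1 ∣s∩q∣≡1 with a ∈? t | a ∈? q
  ... | no a∉t | no a∉q = a , a∉t , a∉q
  ... | yes a∈t | _ = let b∉t , c∉t = Triple-∩-unique tr ∣s∩t∣≡1 a∈t in
    case b ∈? q of λ where
      (yes b∈q) → c , c∉t , proj₁ (Triple-∩-unique (Triple-rotate tr) ∣s∩q∣≡1 b∈q)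
      (no b∉q) → b , b∉t , b∉q
  ... | no a∉t | yes a∈q = let b∉q , c∉q = Triple-∩-unique tr ∣s∩q∣≡1 a∈q in
    case b ∈? t of λ where
      (yes b∈t) → c , proj₁ (Triple-∩-unique (Triple-rotate tr) ∣s∩t∣≡1 b∈t) , c∉q
      (no b∉t) → b , b∉t , b∉q

  ⁅a⁆∪⁅b⁆∪⁅c⁆-Triple : a ≢ b → a ≢ c → b ≢ c → Triple (⁅ a ⁆ ∪ ⁅ b ⁆ ∪ ⁅ c ⁆) a b c
  ⁅a⁆∪⁅b⁆∪⁅c⁆-Triple {a = a} {b = b} {c = c} a≢b a≢c b≢c = record
    { a∈s = x∈p∪q⁺ (inj₁ (x∈⁅x⁆ a))
    ; b∈s = x∈p∪q⁺ (inj₂ (x∈p∪q⁺ (inj₁ (x∈⁅x⁆ b))))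
    ; c∈s = x∈p∪q⁺ (inj₂ (x∈p∪q⁺ (inj₂ (x∈⁅x⁆ c))))
    ; a≢b = a≢b ; a≢c = a≢c ; b≢c = b≢c
    ; members = Sum.map (x∈⁅y⁆⇒x≡y a) (Sum.map (x∈⁅y⁆⇒x≡y b) (x∈⁅y⁆⇒x≡y c) ∘ x∈p∪q⁻ ⁅ b ⁆ ⁅ c ⁆)
              ∘ x∈p∪q⁻ ⁅ a ⁆ (⁅ b ⁆ ∪ ⁅ c ⁆)
    }

  split-off-triple : ∣ s ∣ ≡ 3 + k → ∃ λ e → e ⊆ s × ∣ e ∣ ≡ 3 × ∣ s ─ e ∣ ≡ k
  split-off-triple {s = s} ∣s∣≡3+k
    with a , a∈s , ∣s-a∣≡2+k ← remove-element ∣s∣≡3+k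
    with b , b∈s-a , ∣s-a-b∣≡1+k ← remove-element ∣s-a∣≡2+k
    with c , c∈s-a-b , ∣s-a-b-c∣≡k ← remove-element ∣s-a-b∣≡1+k
    = e , e⊆s , ∣Triple∣≡3 e=abc , ∣s─e∣≡k
    where
    e = ⁅ a ⁆ ∪ ⁅ b ⁆ ∪ ⁅ c ⁆
    c∈s-a = x∈p-y⇒x∈p (s - a) c∈s-a-b
    e=abc : Triple e a b c
    e=abc = ⁅a⁆∪⁅b⁆∪⁅c⁆-Triple (x∈p-y⇒x≢y s b∈s-a ∘ sym) (x∈p-y⇒x≢y s c∈s-a ∘ sym)
                                (x∈p-y⇒x≢y (s - a) c∈s-a-b ∘ sym)
    e⊆s : e ⊆ s
    e⊆s x∈e =
      [ (λ { refl → a∈s }) , [ (λ { refl → x∈p-y⇒x∈p s b∈s-a }) , (λ { refl → x∈p-y⇒x∈p s c∈s-a }) ]′ ]′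
        (Triple.members e=abc x∈e)
    ∣s─e∣≡k : ∣ s ─ e ∣ ≡ _
    ∣s─e∣≡k = begin
      ∣ s ─ e ∣                   ≡⟨ cong ∣_∣ (p─q─r≡p─q∪r s ⁅ a ⁆ (⁅ b ⁆ ∪ ⁅ c ⁆)) ⟨
      ∣ s - a ─ (⁅ b ⁆ ∪ ⁅ c ⁆) ∣ ≡⟨ cong ∣_∣ (p─q─r≡p─q∪r (s - a) ⁅ b ⁆ ⁅ c ⁆) ⟨
      ∣ s - a - b - c ∣           ≡⟨ ∣s-a-b-c∣≡k ⟩
      _                           ∎
      where open ≡-Reasoning

  ∈-[]≔⁺ : x ≢ a → x ∈ p → ∀ side → x ∈ p [ a ]≔ side
  ∈-[]≔⁺ {x = x} {a = a} {p = p} x≢a x∈p _ = []≔-minimal p x a x≢a x∈p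

  ∈-[]≔⁻ : x ≢ a → ∀ side → x ∈ p [ a ]≔ side → x ∈ p
  ∈-[]≔⁻ {x = x} {p = p} x≢a side x∈p′ =
    lookup⇒[]= x p (trans (sym (lookup∘update′ x≢a p side)) ([]=⇒lookup x∈p′))

  a∉p[a]≔outside : a ∉ p [ a ]≔ outside
  a∉p[a]≔outside {a = a} {p = p} a∈p′ with () ← []=-injective ([]≔-updates p a) a∈p′

  b∈move : ∀ e → b ∈ move a b e
  b∈move {b = b} {a = a} e = []≔-updates (e [ a ]≔ outside) b

  a∉move : ∀ e → a ≢ b → a ∉ move a b e
  a∉move e a≢b = a∉p[a]≔outside {p = e} ∘ ∈-[]≔⁻ a≢b inside

  ∈-move⁺ : ∀ {e} → x ∈ e → x ≢ a → x ∈ move a b e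
  ∈-move⁺ {x = x} {b = b} {e = e} x∈e x≢a with x ≟ b
  ... | yes refl = b∈move e
  ... | no x≢b = ∈-[]≔⁺ x≢b (∈-[]≔⁺ x≢a x∈e outside) inside

  ∈-move⁻ : ∀ {e} → x ∈ move a b e → x ≡ b ⊎ (x ≢ a × x ∈ e)
  ∈-move⁻ {x = x} {a = a} {b = b} {e = e} x∈e′ with x ≟ b | x ≟ a
  ... | yes x≡b | _ = inj₁ x≡b
  ... | no x≢b | yes refl = ⊥-elim (a∉p[a]≔outside {p = e} (∈-[]≔⁻ x≢b inside x∈e′))
  ... | no x≢b | no x≢a = inj₂ (x≢a , ∈-[]≔⁻ x≢a outside (∈-[]≔⁻ x≢b inside x∈e′))

  ∉-move : ∀ {e} → x ∉ e → x ≢ b → x ∉ move a b e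
  ∉-move x∉e x≢b x∈e′ = [ x≢b , x∉e ∘ proj₂ ]′ (∈-move⁻ x∈e′)

  move⊆ : ∀ {e S} → b ∈ S → e ⊆ S → move a b e ⊆ S
  move⊆ b∈S e⊆S x∈e′ = [ (λ { refl → b∈S }) , e⊆S ∘ proj₂ ]′ (∈-move⁻ x∈e′)

  move-move : ∀ {e} → a ∈ e → b ∉ e → move b a (move a b e) ≡ e
  move-move {a = a} {b = b} {e = e} a∈e b∉e = ⊆-antisym ⊆e e⊆
    where
    ⊆e : move b a (move a b e) ⊆ e
    ⊆e x∈e″ with ∈-move⁻ x∈e″
    ... | inj₁ refl = a∈e
    ... | inj₂ (x≢b , x∈e′) = [ ⊥-elim ∘ x≢b , proj₂ ]′ (∈-move⁻ x∈e′)
    e⊆ : e ⊆ move b a (move a b e)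
    e⊆ {x} x∈e with x ≟ a
    ... | yes refl = b∈move (move a b e)
    ... | no x≢a = ∈-move⁺ (∈-move⁺ x∈e x≢a) (x∈p∧y∉p⇒x≢y x∈e b∉e)

  ∣move∣ : ∀ {e} → a ∈ e → b ∉ e → ∣ move a b e ∣ ≡ ∣ e ∣
  ∣move∣ {a = a} {b = b} {e = e} a∈e b∉e = begin
    ∣ move a b e ∣       ≡⟨ ∣p∣≡1+∣p-x∣ (b∈move e) ⟩
    suc ∣ move a b e - b ∣ ≡⟨ cong (suc ∘ ∣_∣) (⊆-antisym ⊆e-a e-a⊆) ⟩
    suc ∣ e - a ∣         ≡⟨ ∣p∣≡1+∣p-x∣ a∈e ⟨
    ∣ e ∣                 ∎
    where
    open ≡-Reasoning
    ⊆e-a : move a b e - b ⊆ e - a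
    ⊆e-a x∈ with ∈-move⁻ (x∈p-y⇒x∈p (move a b e) x∈)
    ... | inj₁ x≡b = ⊥-elim (x∈p-y⇒x≢y (move a b e) x∈ x≡b)
    ... | inj₂ (x≢a , x∈e) = x∈p∧x≢y⇒x∈p-y x∈e x≢a
    e-a⊆ : e - a ⊆ move a b e - b
    e-a⊆ x∈ = let x∈e = x∈p-y⇒x∈p e x∈ in
      x∈p∧x≢y⇒x∈p-y (∈-move⁺ x∈e (x∈p-y⇒x≢y e x∈)) (x∈p∧y∉p⇒x≢y x∈e b∉e)

  ∈⇒T : x ∈ p → T (lookup p x)
  ∈⇒T x∈p = Equivalence.from T-≡ ([]=⇒lookup x∈p)

  T⇒∈ : T (lookup p x) → x ∈ p
  T⇒∈ {p = p} {x = x} t = lookup⇒[]= x p (Equivalence.to T-≡ t)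

  T-not⇒∉ : T (not (lookup p x)) → x ∉ p
  T-not⇒∉ t x∈p = subst (T ∘ not) ([]=⇒lookup x∈p) t

  ∉⇒T-not : x ∉ p → T (not (lookup p x))
  ∉⇒T-not {x = x} {p = p} x∉p with lookup p x in eq
  ... | true = x∉p (lookup⇒[]= x p eq)
  ... | false = _

T-not-∧-guard : ∀ {a b c d} → T (not (a ∧ b ∧ not c ∧ not d)) → T a → T b → T (not c) → T d
T-not-∧-guard {true} {true} {false} {true} _ _ _ _ = _
T-not-∧-guard {true} {true} {false} {false} () _ _ _
T-not-∧-guard {true} {true} {true} _ _ _ ()
T-not-∧-guard {true} {false} _ _ ()
T-not-∧-guard {false} _ ()

DisjointEdgesCover : ∀ {n} → Graph n → Set
DisjointEdgesCover {n} G =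
  ∀ {e f : Subset n} {x} → T (G e) → T (G f) → Disjoint e f → x ∉ e → x ∉ f → ⊥

Complete : ∀ {n} → Graph n → Subset n → Set
Complete {n} G S = (e : Subset n) → e ⊆ S → ∣ e ∣ ≡ 3 → T (G e)

DisjointEdgesCover⇒P3Free : ∀ {n} {H : Graph n} → Is3Graph H → DisjointEdgesCover H → P3Free H
DisjointEdgesCover⇒P3Free is3 cover e₁ e₂ e₃ e₁∈H e₂∈H e₃∈H ∣e₁∩e₂∣≡1 ∣e₂∩e₃∣≡1 ∣e₁∩e₃∣≡0 =
  let _ , _ , _ , e₂=abc = ∣s∣≡3⇒∃Triple {s = e₂} (is3 e₂ e₂∈H)
      _ , x∉e₁ , x∉e₃ = Triple-avoids e₂=abc (trans (cong ∣_∣ (∩-comm e₂ e₁)) ∣e₁∩e₂∣≡1) ∣e₂∩e₃∣≡1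
  in cover e₁∈H e₃∈H (∣p∩q∣≡0⇒Disjoint ∣e₁∩e₃∣≡0) x∉e₁ x∉e₃

Complete-6-covers : ∀ {n} {H : Graph n} {S x} →
  DisjointEdgesCover H → ∣ S ∣ ≡ 6 → Complete H S → x ∉ S → ⊥
Complete-6-covers {S = S} cover ∣S∣≡6 S-complete x∉S =
  let e , e⊆S , ∣e∣≡3 , ∣S─e∣≡3 = split-off-triple ∣S∣≡6
  in cover (S-complete e e⊆S ∣e∣≡3) (S-complete (S ─ e) (p─q⊆p S e) ∣S─e∣≡3)
       (λ x∈e x∈S─e → x∈p─q⇒x∉q S e x∈S─e x∈e) (x∉S ∘ e⊆S) (x∉S ∘ p─q⊆p S e)

module _ {n : ℕ} {G : Graph n} (is3 : Is3Graph G) (p3-free : P3Free G) (covers : CoversPairs G)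
  where

  no-bridge : ∀ {e f k a b w} → T (G e) → T (G f) → T (G k) → Disjoint e f →
              Triple k a b w → a ∈ e → b ∈ f → w ∉ e → w ∉ f → ⊥
  no-bridge e∈G f∈G k∈G e∩f=∅ k=abw a∈e b∈f w∉e w∉f =
    p3-free _ _ _ e∈G k∈G f∈G
      (∣p∩Triple∣≡1 k=abw a∈e (Disjoint-sym e∩f=∅ b∈f) w∉e)
      (∣Triple∩∣≡1 (Triple-swap k=abw) b∈f (e∩f=∅ a∈e) w∉f)
      (Disjoint⇒∣p∩q∣≡0 e∩f=∅)

  record Setup : Set where
    field
      {e f g h} : Subset n
      {x a b y z} : Fin n
      e∈G : T (G e)
      f∈G : T (G f)
      g∈G : T (G g)
      h∈G : T (G h)
      e∩f=∅ : Disjoint e f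
      x∉e : x ∉ e
      x∉f : x ∉ f
      a∈e : a ∈ e
      b∈f : b ∈ f
      g=xay : Triple g x a y
      h=xbz : Triple h x b z

  mirror : Setup → Setup
  mirror σ = record
    { e∈G = f∈G ; f∈G = e∈G ; g∈G = h∈G ; h∈G = g∈G ; e∩f=∅ = Disjoint-sym e∩f=∅
    ; x∉e = x∉f ; x∉f = x∉e ; a∈e = b∈f ; b∈f = a∈e ; g=xay = h=xbz ; h=xbz = g=xay }
    where open Setup σ

  module _ (σ : Setup) where
    open Setup σ
    open Triple

    y∉f : y ∉ f
    y∉f y∈f = no-bridge e∈G f∈G g∈G e∩f=∅ (Triple-rotate g=xay) a∈e y∈f x∉e x∉f

    a∉f : a ∉ f
    a∉f = e∩f=∅ a∈e

    b∉e : b ∉ e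
    b∉e = Disjoint-sym e∩f=∅ b∈f

    e∩h=∅ : z ∉ e → Disjoint e h
    e∩h=∅ z∉e = Disjoint-sym (Triple-Disjoint h=xbz x∉e b∉e z∉e)

    path-egh : y ∉ e → z ∈ f → ⊥
    path-egh y∉e z∈f = p3-free e g h e∈G g∈G h∈G
      (∣p∩Triple∣≡1 (Triple-swap g=xay) a∈e x∉e y∉e)
      (∣Triple∩∣≡1 g=xay (a∈s h=xbz) (e∩h=∅ z∉e a∈e) y∉h)
      (Disjoint⇒∣p∩q∣≡0 (e∩h=∅ z∉e))
      where
      z∉e = Disjoint-sym e∩f=∅ z∈f
      y∉h = Triple-∉ h=xbz (a≢c g=xay ∘ sym) (x∉p∧y∈p⇒x≢y y∉f b∈f) (x∉p∧y∈p⇒x≢y y∉f z∈f)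

    path-fkg : ∀ {k w} → y ∉ e → T (G k) → Triple k a b w → w ∈ e → ⊥
    path-fkg y∉e k∈G k=abw w∈e = p3-free f _ g f∈G k∈G g∈G
      (∣p∩Triple∣≡1 (Triple-swap k=abw) b∈f a∉f (e∩f=∅ w∈e))
      (∣Triple∩∣≡1 k=abw (b∈s g=xay) b∉g w∉g)
      (Disjoint⇒∣p∩q∣≡0 (Disjoint-sym (Triple-Disjoint g=xay x∉f a∉f y∉f)))
      where
      b∉g = Triple-∉ g=xay (x∈p∧y∉p⇒x≢y b∈f x∉f) (x∈p∧y∉p⇒x≢y b∈f a∉f) (x∈p∧y∉p⇒x≢y b∈f y∉f)
      w∉g = Triple-∉ g=xay (x∈p∧y∉p⇒x≢y w∈e x∉e) (a≢c k=abw ∘ sym) (x∈p∧y∉p⇒x≢y w∈e y∉e)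

    path-kgh : ∀ {a′ b′ k w} → y ∈ e → z ∈ f → Triple e a y a′ → Triple f b z b′ →
               T (G k) → Triple k a′ b′ w → w ∈ e → ⊥
    path-kgh y∈e z∈f e=aya′ f=bzb′ k∈G k=a′b′w w∈e = p3-free _ g h k∈G g∈G h∈G
      (∣Triple∩∣≡1 (Triple-rotate (Triple-rotate k=a′b′w)) w∈g a′∉g b′∉g)
      (∣Triple∩∣≡1 g=xay (a∈s h=xbz) (e∩h=∅ z∉e a∈e) (e∩h=∅ z∉e y∈e))
      (Disjoint⇒∣p∩q∣≡0 (Triple-Disjoint k=a′b′w (e∩h=∅ z∉e (c∈s e=aya′)) b′∉h (e∩h=∅ z∉e w∈e)))
      where
      z∉e = Disjoint-sym e∩f=∅ z∈f
      b′∈f = c∈s f=bzb′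
      w∈g = [ (λ { refl → b∈s g=xay })
            , [ (λ { refl → c∈s g=xay }) , (λ { refl → ⊥-elim (a≢c k=a′b′w refl) }) ]′
            ]′ (members e=aya′ w∈e)
      a′∉g = Triple-∉ g=xay (x∈p∧y∉p⇒x≢y (c∈s e=aya′) x∉e) (a≢c e=aya′ ∘ sym) (b≢c e=aya′ ∘ sym)
      b′∉g = Triple-∉ g=xay (x∈p∧y∉p⇒x≢y b′∈f x∉f) (x∈p∧y∉p⇒x≢y b′∈f a∉f) (x∈p∧y∉p⇒x≢y b′∈f y∉f)
      b′∉h = Triple-∉ h=xbz (x∈p∧y∉p⇒x≢y b′∈f x∉f) (a≢c f=bzb′ ∘ sym) (b≢c f=bzb′ ∘ sym)

  edge-through : ∀ {x a} → x ≢ a → ∃ λ g → T (G g) × ∃ (Triple g x a)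
  edge-through {x} {a} x≢a =
    let g , g∈G , x∈g , a∈g = covers x a x≢a in g , g∈G , ∣s∣≡3⇒Triple (is3 g g∈G) x∈g a∈g x≢a

  module _ (σ : Setup) where
    open Setup σ
    open Triple

    both-inside : y ∈ e → z ∈ f → ⊥
    both-inside y∈e z∈f =
      let _ , e=aya′ = ∣s∣≡3⇒Triple (is3 e e∈G) a∈e y∈e (b≢c g=xay)
          _ , f=bzb′ = ∣s∣≡3⇒Triple (is3 f f∈G) b∈f z∈f (b≢c h=xbz)
          _ , k∈G , _ , k=a′b′w =
            edge-through (x∈p∧y∉p⇒x≢y (c∈s e=aya′) (Disjoint-sym e∩f=∅ (c∈s f=bzb′)))
      in no-bridge e∈G f∈G k∈G e∩f=∅ k=a′b′w (c∈s e=aya′) (c∈s f=bzb′)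
           (path-kgh σ y∈e z∈f e=aya′ f=bzb′ k∈G k=a′b′w)
           (path-kgh (mirror σ) z∈f y∈e f=bzb′ e=aya′ k∈G (Triple-swap k=a′b′w))

    both-outside : y ∉ e → z ∉ f → ⊥
    both-outside y∉e z∉f =
      let _ , k∈G , _ , k=abw = edge-through (x∈p∧y∉p⇒x≢y a∈e (b∉e σ))
      in no-bridge e∈G f∈G k∈G e∩f=∅ k=abw a∈e b∈f
           (path-fkg σ y∉e k∈G k=abw)
           (path-fkg (mirror σ) z∉f k∈G (Triple-swap k=abw))

    ¬Setup : ⊥
    ¬Setup with y ∈? e | z ∈? f
    ... | yes y∈e | yes z∈f = both-inside y∈e z∈f
    ... | yes y∈e | no z∉f = path-egh (mirror σ) z∉f y∈e
    ... | no y∉e | yes z∈f = path-egh σ y∉e z∈f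
    ... | no y∉e | no z∉f = both-outside y∉e z∉f

  P3Free⇒DisjointEdgesCover : DisjointEdgesCover G
  P3Free⇒DisjointEdgesCover {e} {f} e∈G f∈G e∩f=∅ x∉e x∉f =
    let _ , a∈e = ∣p∣≡1+k⇒Nonempty (is3 e e∈G)
        _ , b∈f = ∣p∣≡1+k⇒Nonempty (is3 f f∈G)
        _ , g∈G , _ , g=xay = edge-through (x∉p∧y∈p⇒x≢y x∉e a∈e)
        _ , h∈G , _ , h=xbz = edge-through (x∉p∧y∈p⇒x≢y x∉f b∈f)
    in ¬Setup (record
         { e∈G = e∈G ; f∈G = f∈G ; g∈G = g∈G ; h∈G = h∈G ; e∩f=∅ = e∩f=∅
         ; x∉e = x∉e ; x∉f = x∉f ; a∈e = a∈e ; b∈f = b∈f ; g=xay = g=xay ; h=xbz = h=xbz })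

module Compression {n : ℕ} {G : Graph n} (is3 : Is3Graph G) {i j : Fin n} (i≢j : i ≢ j) where

  data Compressed (e : Subset n) : Set where
    kept    : T (G e) → (j ∈ e → i ∉ e → T (G (move j i e))) → Compressed e
    shifted : ∣ e ∣ ≡ 3 → i ∈ e → j ∉ e → T (G (move i j e)) → Compressed e

  compressed : ∀ {e} → T (compress i j G e) → Compressed e
  compressed {e} e∈π with Equivalence.to T-∨ e∈π
  ... | inj₁ kept-part =
    let e∈G , guard = Equivalence.to T-∧ kept-part
    in kept e∈G λ j∈e i∉e → T-not-∧-guard guard (≡⇒≡ᵇ _ _ (is3 e e∈G)) (∈⇒T j∈e) (∉⇒T-not i∉e)
  ... | inj₂ shifted-part =
    let ∣e∣≡ᵇ3 , rest = Equivalence.to T-∧ shifted-part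
        i∈e , rest = Equivalence.to T-∧ rest
        j∉e , rest = Equivalence.to T-∧ rest
        e′∈G , _ = Equivalence.to T-∧ rest
    in shifted (≡ᵇ⇒≡ _ 3 ∣e∣≡ᵇ3) (T⇒∈ i∈e) (T-not⇒∉ j∉e) e′∈G

  compress-Is3Graph : Is3Graph (compress i j G)
  compress-Is3Graph e e∈π with compressed e∈π
  ... | kept e∈G _ = is3 e e∈G
  ... | shifted ∣e∣≡3 _ _ _ = ∣e∣≡3

  shifted-kept-cover : ∀ {e f x} → DisjointEdgesCover G →
    i ∈ e → j ∉ e → T (G (move i j e)) → T (G f) → (j ∈ f → i ∉ f → T (G (move j i f))) →
    Disjoint e f → x ∉ e → x ∉ f → ⊥
  shifted-kept-cover {e} {f} {x} cover i∈e j∉e e′∈G f∈G f-kept e∩f=∅ x∉e x∉f with j ∈? f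
  ... | no j∉f = cover e′∈G f∈G e′∩f=∅ (a∉move e i≢j) (e∩f=∅ i∈e)
    where
    e′∩f=∅ : Disjoint (move i j e) f
    e′∩f=∅ y∈e′ = [ (λ { refl → j∉f }) , e∩f=∅ ∘ proj₂ ]′ (∈-move⁻ y∈e′)
  ... | yes j∈f = cover e′∈G (f-kept j∈f (e∩f=∅ i∈e)) e′∩f′=∅
                    (∉-move x∉e (x∉p∧y∈p⇒x≢y x∉f j∈f)) (∉-move x∉f (x∉p∧y∈p⇒x≢y x∉e i∈e))
    where
    e′∩f′=∅ : Disjoint (move i j e) (move j i f)
    e′∩f′=∅ y∈e′ y∈f′ with ∈-move⁻ y∈e′ | ∈-move⁻ y∈f′
    ... | inj₁ refl | inj₁ refl = i≢j refl
    ... | inj₁ refl | inj₂ (j≢j , _) = j≢j refl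
    ... | inj₂ (i≢i , _) | inj₁ refl = i≢i refl
    ... | inj₂ (_ , y∈e) | inj₂ (_ , y∈f) = e∩f=∅ y∈e y∈f

  compress-DisjointEdgesCover : DisjointEdgesCover G → DisjointEdgesCover (compress i j G)
  compress-DisjointEdgesCover cover e∈π f∈π e∩f=∅ x∉e x∉f with compressed e∈π | compressed f∈π
  ... | kept e∈G _ | kept f∈G _ = cover e∈G f∈G e∩f=∅ x∉e x∉f
  ... | shifted _ i∈e _ _ | shifted _ i∈f _ _ = e∩f=∅ i∈e i∈f
  ... | shifted _ i∈e j∉e e′∈G | kept f∈G f-kept =
    shifted-kept-cover cover i∈e j∉e e′∈G f∈G f-kept e∩f=∅ x∉e x∉f
  ... | kept e∈G e-kept | shifted _ i∈f j∉f f′∈G =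
    shifted-kept-cover cover i∈f j∉f f′∈G e∈G e-kept (Disjoint-sym e∩f=∅) x∉f x∉e

  compress-Complete : ∀ {S} → j ∈ S → Complete (compress i j G) S → Complete G S
  compress-Complete j∈S S-complete e e⊆S ∣e∣≡3 with compressed (S-complete e e⊆S ∣e∣≡3)
  ... | kept e∈G _ = e∈G
  ... | shifted _ i∈e j∉e _
    with compressed (S-complete (move i j e) (move⊆ j∈S e⊆S) (trans (∣move∣ i∈e j∉e) ∣e∣≡3))
  ...   | kept _ e′-kept = subst (T ∘ G) (move-move i∈e j∉e) (e′-kept (b∈move e) (a∉move e i≢j))
  ...   | shifted _ i∈e′ _ _ = ⊥-elim (a∉move e i≢j i∈e′)

  compress-K6Free : DisjointEdgesCover G → K6Free G → K6Free (compress i j G)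
  compress-K6Free cover K6-free (S , ∣S∣≡6 , S-complete) with j ∈? S
  ... | yes j∈S = K6-free (S , ∣S∣≡6 , compress-Complete j∈S S-complete)
  ... | no j∉S = Complete-6-covers (compress-DisjointEdgesCover cover) ∣S∣≡6 S-complete j∉S

mainTheorem5 : (n : ℕ) → n ≥ 6 → (F : Graph n) → Is3Graph F → P3Free F →
    CoversPairs F → (i j : Fin n) → i ≢ j →
    P3Free (compress i j F) × (K6Free F → K6Free (compress i j F))
mainTheorem5 _ _ F is3 p3-free covers i j i≢j =
  DisjointEdgesCover⇒P3Free compress-Is3Graph (compress-DisjointEdgesCover cover) ,
  compress-K6Free cover
  where
  open Compression is3 i≢j
  cover : DisjointEdgesCover F
  cover = P3Free⇒DisjointEdgesCover is3 p3-free covers
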